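{- Let $C$ be a simple Chip Firing Game whose support graph has a unique sink $\bot$, let $v\neq\bot$ be a vertex, and let $n\ge 0$ be an integer. Let $C'$ be obtained from $C$ by adding $n$ chips to $v$ in the initial configuration and adding $n$ edges $(v,\bot)$ (the Grounding Modification). Then $C'$ is equivalent to $C$.
   Context: A Chip Firing Game (CFG) is played on a finite directed multigraph with an initial configuration $\sigma_0:V\to\mathbb{N}$ of chips. A vertex $v$ with at least one outgoing edge and at least $d^+(v)$ chips (its outdegree) may be fired, sending one chip along each outgoing edge. A sink is a vertex with no outgoing edges. The configuration space is the set of configurations reachable from $\sigma_0$, ordered by reachability. The game is convergent if it reaches a final configuration in which no firing is possible. An execution is a firing sequence from the initial configuration to the final one. A convergent CFG is simple if each vertex is fired at most once during an execution. Two convergent CFGs are equivalent if their configuration spaces are isomorphic posets. Standing assumptions: the support graph has no loops, and every vertex other than $\bot$ is fired during an execution. -}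

module Defs where

open import Data.Nat using (ℕ; zero; suc; _+_; _∸_; _≤_; _<_)
open import Data.Fin using (Fin; _≟_)
open import Data.Vec using (Vec; lookup; tabulate; updateAt; sum)
open import Data.List using (List; []; _∷_)
open import Data.List.Membership.Propositional using (_∈_)
open import Data.List.Relation.Unary.Unique.Propositional using (Unique)
open import Data.Product using (Σ; ∃; _×_; _,_)
open import Function.Bundles using (_⇔_)
open import Relation.Nullary using (¬_; does)
open import Relation.Binary.PropositionalEquality using (_≡_; _≢_)
open import Data.Bool using (if_then_else_)

-- A directed multigraph on vertex set Fin n: E u w = number of edges (u , w).
Graph : ℕ → Set
Graph n = Fin n → Fin n → ℕ

Config : ℕ → Set
Config n = Vec ℕ n

module _ {n : ℕ} (E : Graph n) where

  outdeg : Fin n → ℕ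
  outdeg v = sum (tabulate (E v))

  Firable : Config n → Fin n → Set
  Firable σ v = (0 < outdeg v) × (outdeg v ≤ lookup σ v)

  fire : Config n → Fin n → Config n
  fire σ v = tabulate λ w →
    (lookup σ w ∸ (if does (w ≟ v) then outdeg v else 0)) + E v w

  data Fires : Config n → List (Fin n) → Config n → Set where
    done : ∀ {σ} → Fires σ [] σ
    step : ∀ {σ v l τ} → Firable σ v → Fires (fire σ v) l τ → Fires σ (v ∷ l) τ

  Reach : Config n → Config n → Set
  Reach σ τ = ∃ λ l → Fires σ l τ

  Final : Config n → Set
  Final σ = ∀ v → ¬ Firable σ v

  Execution : Config n → List (Fin n) → Set
  Execution σ₀ l = ∃ λ τ → Fires σ₀ l τ × Final τ

  Convergent : Config n → Set
  Convergent σ₀ = ∃ λ τ → Reach σ₀ τ × Final τ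

  Simple : Config n → Set
  Simple σ₀ = Convergent σ₀ × (∀ l → Execution σ₀ l → Unique l)

  IsSink : Fin n → Set
  IsSink w = ∀ u → E w u ≡ 0

  UniqueSink : Fin n → Set
  UniqueSink ⊥ = IsSink ⊥ × (∀ w → IsSink w → w ≡ ⊥)

  NoLoops : Set
  NoLoops = ∀ w → E w w ≡ 0

  -- standing assumption: every vertex other than ⊥ is fired in an execution
  AllFired : Config n → Fin n → Set
  AllFired σ₀ ⊥ = ∀ l → Execution σ₀ l → ∀ w → w ≢ ⊥ → w ∈ l

-- Two games on the same vertex set are equivalent if their configuration
-- spaces (reachable configurations ordered by reachability) are isomorphic
-- posets: an order isomorphism between the reachable sets.
Equivalent : {n : ℕ} → Graph n → Config n → Graph n → Config n → Set
Equivalent {n} E σ₀ E' σ₀' =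
  Σ (Config n → Config n) λ f → Σ (Config n → Config n) λ g →
    (∀ σ → Reach E σ₀ σ → Reach E' σ₀' (f σ)) ×
    (∀ τ → Reach E' σ₀' τ → Reach E σ₀ (g τ)) ×
    (∀ σ → Reach E σ₀ σ → g (f σ) ≡ σ) ×
    (∀ τ → Reach E' σ₀' τ → f (g τ) ≡ τ) ×
    (∀ σ τ → Reach E σ₀ σ → Reach E σ₀ τ →
       (Reach E σ τ ⇔ Reach E' (f σ) (f τ)))

groundGraph : {n : ℕ} → Graph n → Fin n → Fin n → ℕ → Graph n
groundGraph E v ⊥ k a b =
  if does (a ≟ v) then (if does (b ≟ ⊥) then E a b + k else E a b) else E a b

groundConfig : {n : ℕ} → Config n → Fin n → ℕ → Config n
groundConfig σ v k = updateAt σ v (_+ k)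

-- Least action: a legal firing sequence never fires a vertex more often than an execution does,
-- so in a simple game every vertex fires at most once, and by the standing assumption v fires
-- exactly once along every maximal firing sequence. A configuration σ of C thus corresponds to σ
-- with the k extra chips on v while v has not fired, and on ⊥ afterwards: firing v in C′ moves
-- exactly those chips to ⊥, while chips on ⊥ never affect firability. Whether v has fired can be
-- read off σ alone, by greedily completing the game from σ and checking whether v fires.
module Submission where

open import Defs
open import Data.Nat using (ℕ; zero; suc; _+_; _∸_; _*_; _≤_; _≰_; _<_; z≤n; s≤s)
open import Data.Nat.Properties hiding (_≟_; suc-injective)
open import Algebra.Properties.CommutativeSemigroup +-commutativeSemigroup using (xy∙z≈xz∙y; xy∙z≈x∙zy)
open import Data.Fin using (Fin; _≟_) renaming (zero to fzero; suc to fsuc)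
open import Data.Fin.Properties using (any?; suc-injective)
open import Data.Vec using (Vec; lookup; tabulate; updateAt; sum)
open import Data.Vec.Properties using (lookup∘updateAt; lookup∘updateAt′; lookup∘tabulate; tabulate∘lookup; tabulate-cong; updateAt-updateAt; updateAt-cong; updateAt-id)
open import Data.List using (List; []; _∷_; _++_; [_])
open import Data.List.Properties using (++-assoc; ++-identityʳ)
open import Data.List.Membership.Propositional using (_∈_)
open import Data.List.Relation.Unary.Any using (here; there)
open import Data.List.Relation.Unary.All using (All; []; _∷_)
open import Data.List.Relation.Unary.AllPairs using ([]; _∷_)
open import Data.List.Relation.Unary.Unique.Propositional using (Unique)
open import Data.Product using (∃; _×_; _,_; proj₁; proj₂)
open import Data.Bool using (if_then_else_)
open import Function using (_∘_)
open import Function.Bundles using (_⇔_; mk⇔)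
open import Relation.Nullary using (¬_; does; yes; no; Dec; contradiction)
open import Relation.Nullary.Decidable using (_×-dec_; dec-true; dec-false)
open import Relation.Binary.PropositionalEquality hiding ([_])

sum-tabulate-update : ∀ {m} (g h : Fin m → ℕ) (u : Fin m) {c : ℕ} →
  (∀ w → w ≢ u → g w ≡ h w) → g u ≡ h u + c → sum (tabulate g) ≡ sum (tabulate h) + c
sum-tabulate-update g h fzero {c} g≡h gu≡ = begin
    g fzero + sum (tabulate (g ∘ fsuc))
  ≡⟨ cong₂ _+_ gu≡ (cong sum (tabulate-cong λ w → g≡h (fsuc w) λ ())) ⟩
    h fzero + c + sum (tabulate (h ∘ fsuc))
  ≡⟨ xy∙z≈xz∙y (h fzero) c _ ⟩
    h fzero + sum (tabulate (h ∘ fsuc)) + c ∎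
  where open ≡-Reasoning
sum-tabulate-update g h (fsuc u) {c} g≡h gu≡ = begin
    g fzero + sum (tabulate (g ∘ fsuc))
  ≡⟨ cong₂ _+_ (g≡h fzero λ ()) (sum-tabulate-update (g ∘ fsuc) (h ∘ fsuc) u
       (λ w w≢u → g≡h (fsuc w) (w≢u ∘ suc-injective)) gu≡) ⟩
    h fzero + (sum (tabulate (h ∘ fsuc)) + c)
  ≡⟨ +-assoc (h fzero) _ c ⟨
    h fzero + sum (tabulate (h ∘ fsuc)) + c ∎
  where open ≡-Reasoning

sum-tabulate-mono : ∀ {m} (g h : Fin m → ℕ) → (∀ w → g w ≤ h w) → sum (tabulate g) ≤ sum (tabulate h)
sum-tabulate-mono {zero} g h g≤h = z≤n
sum-tabulate-mono {suc m} g h g≤h = +-mono-≤ (g≤h fzero) (sum-tabulate-mono (g ∘ fsuc) (h ∘ fsuc) (g≤h ∘ fsuc))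

lookup≤sum-tabulate : ∀ {m} (g : Fin m → ℕ) (u : Fin m) → g u ≤ sum (tabulate g)
lookup≤sum-tabulate g fzero = m≤m+n _ _
lookup≤sum-tabulate g (fsuc u) = ≤-trans (lookup≤sum-tabulate (g ∘ fsuc) u) (m≤n+m _ _)

sum-tabulate-≤-length : ∀ {m} (g : Fin m → ℕ) → (∀ w → g w ≤ 1) → sum (tabulate g) ≤ m
sum-tabulate-≤-length {zero} g g≤1 = z≤n
sum-tabulate-≤-length {suc m} g g≤1 = +-mono-≤ (g≤1 fzero) (sum-tabulate-≤-length (g ∘ fsuc) (g≤1 ∘ fsuc))

sum-tabulate-zero : ∀ {m} (g : Fin m → ℕ) → (∀ w → g w ≡ 0) → sum (tabulate g) ≡ 0
sum-tabulate-zero {zero} g g≡0 = refl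
sum-tabulate-zero {suc m} g g≡0 rewrite g≡0 fzero = sum-tabulate-zero (g ∘ fsuc) (g≡0 ∘ fsuc)

lookup-extensionality : ∀ {m} {A : Set} (xs ys : Vec A m) → (∀ i → lookup xs i ≡ lookup ys i) → xs ≡ ys
lookup-extensionality xs ys eq = trans (sym (tabulate∘lookup xs)) (trans (tabulate-cong eq) (tabulate∘lookup ys))

∸-+-restore : ∀ {a x} e → x ≤ a → a ∸ x + e + x ≡ a + e
∸-+-restore {a} {x} e x≤a = begin
  a ∸ x + e + x  ≡⟨ xy∙z≈xz∙y (a ∸ x) e x ⟩
  a ∸ x + x + e  ≡⟨ cong (_+ e) (m∸n+n≡m x≤a) ⟩
  a + e          ∎
  where open ≡-Reasoning

module _ {n : ℕ} where

  count : Fin n → List (Fin n) → ℕ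
  count w [] = 0
  count w (u ∷ l) = if does (w ≟ u) then suc (count w l) else count w l

  count-self : ∀ w l → count w (w ∷ l) ≡ suc (count w l)
  count-self w l rewrite dec-true (w ≟ w) refl = refl

  count-other : ∀ {w u} l → w ≢ u → count w (u ∷ l) ≡ count w l
  count-other {w} {u} l w≢u rewrite dec-false (w ≟ u) w≢u = refl

  count-++ : ∀ w a b → count w (a ++ b) ≡ count w a + count w b
  count-++ w [] b = refl
  count-++ w (u ∷ a) b with w ≟ u
  ... | yes _ = cong suc (count-++ w a b)
  ... | no _ = count-++ w a b

  count-snoc-self : ∀ w a → count w (a ++ [ w ]) ≡ suc (count w a)
  count-snoc-self w a = trans (count-++ w a [ w ]) (trans (cong (count w a +_) (count-self w [])) (+-comm (count w a) 1))

  count-snoc-other : ∀ {w u} a → w ≢ u → count w (a ++ [ u ]) ≡ count w a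
  count-snoc-other {w} a w≢u = trans (count-++ w a _) (trans (cong (count w a +_) (count-other [] w≢u)) (+-identityʳ _))

  count-absent : ∀ w l → All (w ≢_) l → count w l ≡ 0
  count-absent w [] [] = refl
  count-absent w (u ∷ l) (w≢u ∷ ws) = trans (count-other l w≢u) (count-absent w l ws)

  count≤1 : ∀ w l → Unique l → count w l ≤ 1
  count≤1 w [] [] = z≤n
  count≤1 w (u ∷ l) (u∉l ∷ uniq) with w ≟ u
  ... | yes refl = s≤s (≤-reflexive (count-absent w l u∉l))
  ... | no _ = count≤1 w l uniq

  ∈⇒0<count : ∀ {w l} → w ∈ l → 0 < count w l
  ∈⇒0<count {w} {_ ∷ l} (here refl) = subst (0 <_) (sym (count-self w l)) (s≤s z≤n)
  ∈⇒0<count {w} {u ∷ l} (there w∈l) with w ≟ u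
  ... | yes _ = s≤s z≤n
  ... | no _ = ∈⇒0<count w∈l

  infix 4 _⊑_
  _⊑_ : List (Fin n) → List (Fin n) → Set
  a ⊑ b = ∀ w → count w a ≤ count w b

addChips removeChips : ∀ {n} → Config n → Fin n → ℕ → Config n
addChips σ w c = updateAt σ w (_+ c)
removeChips σ w c = updateAt σ w (_∸ c)

removeChips-addChips : ∀ {n} (σ : Config n) w c → removeChips (addChips σ w c) w c ≡ σ
removeChips-addChips σ w c = begin
  updateAt (updateAt σ w (_+ c)) w (_∸ c)  ≡⟨ updateAt-updateAt w σ ⟩
  updateAt σ w (λ x → x + c ∸ c)           ≡⟨ updateAt-cong w (λ x → m+n∸n≡m x c) σ ⟩
  updateAt σ w (λ x → x)                   ≡⟨ updateAt-id w σ ⟩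
  σ                                        ∎
  where open ≡-Reasoning

lookup-addChips-other : ∀ {n} (σ : Config n) {w u} c → w ≢ u → lookup (addChips σ w c) u ≡ lookup σ u
lookup-addChips-other σ {w} {u} c w≢u = lookup∘updateAt′ u w (w≢u ∘ sym) σ

lookup-addChips-≥ : ∀ {n} (σ : Config n) w c u → lookup σ u ≤ lookup (addChips σ w c) u
lookup-addChips-≥ σ w c u with w ≟ u
... | yes refl = ≤-trans (m≤m+n _ c) (≤-reflexive (sym (lookup∘updateAt u σ)))
... | no w≢u = ≤-reflexive (sym (lookup-addChips-other σ c w≢u))

lookup-addChips-≤ : ∀ {n} (σ : Config n) w c u → lookup (addChips σ w c) u ≤ lookup σ u + c
lookup-addChips-≤ σ w c u with w ≟ u
... | yes refl = ≤-reflexive (lookup∘updateAt u σ)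
... | no w≢u = ≤-trans (≤-reflexive (lookup-addChips-other σ c w≢u)) (m≤m+n _ c)

lookup-removeChips-≤ : ∀ {n} (σ : Config n) w c u → lookup (removeChips σ w c) u ≤ lookup σ u
lookup-removeChips-≤ σ w c u with w ≟ u
... | yes refl = ≤-trans (≤-reflexive (lookup∘updateAt u σ)) (m∸n≤m _ c)
... | no w≢u = ≤-reflexive (lookup∘updateAt′ u w (w≢u ∘ sym) σ)

module ChipFiring {n : ℕ} (E : Graph n) where

  debit : Fin n → Fin n → ℕ
  debit u w = if does (w ≟ u) then outdeg E u else 0

  fire-lookup : ∀ σ u w → lookup (fire E σ u) w ≡ lookup σ w ∸ debit u w + E u w
  fire-lookup σ u w = lookup∘tabulate _ w

  fire-lookup-self : ∀ σ u → lookup (fire E σ u) u ≡ lookup σ u ∸ outdeg E u + E u u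
  fire-lookup-self σ u =
    trans (fire-lookup σ u u) (cong (λ b → lookup σ u ∸ (if b then outdeg E u else 0) + E u u) (dec-true (u ≟ u) refl))

  fire-lookup-other : ∀ σ {u w} → w ≢ u → lookup (fire E σ u) w ≡ lookup σ w + E u w
  fire-lookup-other σ {u} {w} w≢u =
    trans (fire-lookup σ u w) (cong (λ b → lookup σ w ∸ (if b then outdeg E u else 0) + E u w) (dec-false (w ≟ u) w≢u))

  debit≤ : ∀ σ {u} w → outdeg E u ≤ lookup σ u → debit u w ≤ lookup σ w
  debit≤ σ {u} w d≤σu with w ≟ u
  ... | yes refl = d≤σu
  ... | no _ = z≤n

  sink-outdeg : ∀ {w} → IsSink E w → outdeg E w ≡ 0
  sink-outdeg {w} sink = sum-tabulate-zero (E w) sink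

  active⇒¬sink : ∀ {u w} → 0 < outdeg E u → IsSink E w → u ≢ w
  active⇒¬sink 0<d sink refl = <-irrefl (sym (sink-outdeg sink)) 0<d

  ¬sink⇒active : ∀ {w} → ¬ IsSink E w → 0 < outdeg E w
  ¬sink⇒active {w} ¬sink with outdeg E w in d≡0
  ... | zero = contradiction (λ u → n≤0⇒n≡0 (subst (E w u ≤_) d≡0 (lookup≤sum-tabulate (E w) u))) ¬sink
  ... | suc _ = s≤s z≤n

  fire-conserves : ∀ σ u w → outdeg E u ≤ lookup σ u → lookup (fire E σ u) w + debit u w ≡ lookup σ w + E u w
  fire-conserves σ u w d≤σu = trans (cong (_+ debit u w) (fire-lookup σ u w)) (∸-+-restore (E u w) (debit≤ σ w d≤σu))

  fires-++ : ∀ {σ a ρ b τ} → Fires E σ a ρ → Fires E ρ b τ → Fires E σ (a ++ b) τ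
  fires-++ done fb = fb
  fires-++ (step firable fa) fb = step firable (fires-++ fa fb)

  fires-snoc : ∀ {σ a ρ u} → Fires E σ a ρ → Firable E ρ u → Fires E σ (a ++ [ u ]) (fire E ρ u)
  fires-snoc fa firable = fires-++ fa (step firable done)

  reach-trans : ∀ {σ ρ τ} → Reach E σ ρ → Reach E ρ τ → Reach E σ τ
  reach-trans (a , fa) (b , fb) = a ++ b , fires-++ fa fb

  fire-addChips : ∀ {σ u} w c → outdeg E u ≤ lookup σ u → fire E (addChips σ w c) u ≡ addChips (fire E σ u) w c
  fire-addChips {σ} {u} w c d≤σu = lookup-extensionality _ _ λ x → begin
      lookup (fire E (addChips σ w c) u) x
    ≡⟨ fire-lookup (addChips σ w c) u x ⟩
      lookup (addChips σ w c) x ∸ debit u x + E u x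
    ≡⟨ shift x ⟩
      lookup (addChips (fire E σ u) w c) x ∎
    where
    open ≡-Reasoning
    shift : ∀ x → lookup (addChips σ w c) x ∸ debit u x + E u x ≡ lookup (addChips (fire E σ u) w c) x
    shift x with w ≟ x
    ... | yes refl = begin
        lookup (addChips σ x c) x ∸ debit u x + E u x
      ≡⟨ cong (λ y → y ∸ debit u x + E u x) (lookup∘updateAt x σ) ⟩
        lookup σ x + c ∸ debit u x + E u x
      ≡⟨ cong (_+ E u x) (+-∸-comm c (debit≤ σ x d≤σu)) ⟩
        lookup σ x ∸ debit u x + c + E u x
      ≡⟨ xy∙z≈xz∙y (lookup σ x ∸ debit u x) c (E u x) ⟩
        lookup σ x ∸ debit u x + E u x + c
      ≡⟨ cong (_+ c) (fire-lookup σ u x) ⟨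
        lookup (fire E σ u) x + c
      ≡⟨ lookup∘updateAt x (fire E σ u) ⟨
        lookup (addChips (fire E σ u) x c) x ∎
    ... | no w≢x rewrite lookup-addChips-other σ c w≢x | lookup-addChips-other (fire E σ u) c w≢x =
      sym (fire-lookup σ u x)

  received : List (Fin n) → Fin n → ℕ
  received l w = sum (tabulate λ u → count u l * E u w)

  received-[] : ∀ w → received [] w ≡ 0
  received-[] w = sum-tabulate-zero (λ u → 0 * E u w) (λ _ → refl)

  received-∷ : ∀ u l w → received (u ∷ l) w ≡ received l w + E u w
  received-∷ u l w = sum-tabulate-update _ _ u
    (λ x x≢u → cong (_* E x w) (count-other l x≢u))
    (trans (cong (_* E u w) (count-self u l)) (+-comm (E u w) _))

  received-mono : ∀ {a b} → a ⊑ b → ∀ w → received a w ≤ received b w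
  received-mono a⊑b w = sum-tabulate-mono _ _ λ u → *-monoˡ-≤ (E u w) (a⊑b u)

  conservation : ∀ {σ l τ} → Fires E σ l τ → ∀ w →
    lookup τ w + count w l * outdeg E w ≡ lookup σ w + received l w
  conservation {σ} done w = cong (lookup σ w +_) (sym (received-[] w))
  conservation {σ} (step {v = u} {l = l} {τ = τ} (_ , d≤σu) rest) w = begin
      lookup τ w + count w (u ∷ l) * outdeg E w
    ≡⟨ cong (lookup τ w +_) count-∷-outdeg ⟩
      lookup τ w + (count w l * outdeg E w + debit u w)
    ≡⟨ +-assoc (lookup τ w) _ (debit u w) ⟨
      lookup τ w + count w l * outdeg E w + debit u w
    ≡⟨ cong (_+ debit u w) (conservation rest w) ⟩
      lookup (fire E σ u) w + received l w + debit u w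
    ≡⟨ xy∙z≈xz∙y (lookup (fire E σ u) w) _ (debit u w) ⟩
      lookup (fire E σ u) w + debit u w + received l w
    ≡⟨ cong (_+ received l w) (fire-conserves σ u w d≤σu) ⟩
      lookup σ w + E u w + received l w
    ≡⟨ xy∙z≈x∙zy (lookup σ w) (E u w) (received l w) ⟩
      lookup σ w + (received l w + E u w)
    ≡⟨ cong (lookup σ w +_) (received-∷ u l w) ⟨
      lookup σ w + received (u ∷ l) w ∎
    where
    open ≡-Reasoning
    count-∷-outdeg : count w (u ∷ l) * outdeg E w ≡ count w l * outdeg E w + debit u w
    count-∷-outdeg with w ≟ u
    ... | yes refl = +-comm (outdeg E w) _
    ... | no _ = sym (+-identityʳ _)

  module LeastAction {σ₀ l τ} (execution : Fires E σ₀ l τ) (final : Final E τ) where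

    -- If u fired as often as in the execution, conservation would leave at least as many chips on u as in τ.
    firable⇒count< : ∀ {a σ u} → Fires E σ₀ a σ → a ⊑ l → Firable E σ u → count u a < count u l
    firable⇒count< {a} {σ} {u} fa a⊑l (0<d , d≤σu) with count u a <? count u l
    ... | yes a<l = a<l
    ... | no a≮l = contradiction (0<d , ≤-trans d≤σu σu≤τu) (final u)
      where
      open ≤-Reasoning
      same-count : count u a ≡ count u l
      same-count = ≤-antisym (a⊑l u) (≮⇒≥ a≮l)
      σu≤τu : lookup σ u ≤ lookup τ u
      σu≤τu = +-cancelʳ-≤ (count u l * outdeg E u) _ _ (begin
          lookup σ u + count u l * outdeg E u
        ≡⟨ cong (λ c → lookup σ u + c * outdeg E u) same-count ⟨
          lookup σ u + count u a * outdeg E u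
        ≡⟨ conservation fa u ⟩
          lookup σ₀ u + received a u
        ≤⟨ +-monoʳ-≤ (lookup σ₀ u) (received-mono {a} {l} a⊑l u) ⟩
          lookup σ₀ u + received l u
        ≡⟨ conservation execution u ⟨
          lookup τ u + count u l * outdeg E u ∎)

    ⊑-extend : ∀ {a σ b ρ} → Fires E σ₀ a σ → a ⊑ l → Fires E σ b ρ → a ++ b ⊑ l
    ⊑-extend {a} fa a⊑l done rewrite ++-identityʳ a = a⊑l
    ⊑-extend {a} fa a⊑l (step {v = u} {l = b} firable rest) rewrite sym (++-assoc a [ u ] b) =
      ⊑-extend (fires-snoc fa firable) au⊑l rest
      where
      au⊑l : a ++ [ u ] ⊑ l
      au⊑l w with w ≟ u
      ... | yes refl = subst (_≤ count w l) (sym (count-snoc-self w a)) (firable⇒count< fa a⊑l firable)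
      ... | no w≢u = subst (_≤ count w l) (sym (count-snoc-other a w≢u)) (a⊑l w)

    least-action : ∀ {a σ} → Fires E σ₀ a σ → a ⊑ l
    least-action = ⊑-extend done (λ _ → z≤n)

  firable? : ∀ σ u → Dec (Firable E σ u)
  firable? σ u = (0 <? outdeg E u) ×-dec (outdeg E u ≤? lookup σ u)

  greedy : ℕ → Config n → List (Fin n)
  greedy zero σ = []
  greedy (suc m) σ with any? (firable? σ)
  ... | yes (u , _) = u ∷ greedy m (fire E σ u)
  ... | no _ = []

  greedy-fires : ∀ m σ → ∃ λ τ → Fires E σ (greedy m σ) τ
  greedy-fires zero σ = σ , done
  greedy-fires (suc m) σ with any? (firable? σ)
  ... | yes (u , firable) = let τ , fires = greedy-fires m (fire E σ u) in τ , step firable fires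
  ... | no _ = σ , done

  fires-monotone : ∀ {σ r ρ} σ′ → (∀ w → 0 < outdeg E w → lookup σ w ≤ lookup σ′ w) →
    Fires E σ r ρ → ∃ λ ρ′ → Fires E σ′ r ρ′
  fires-monotone σ′ σ≤σ′ done = σ′ , done
  fires-monotone {σ} σ′ σ≤σ′ (step {v = u} (0<d , d≤σu) rest) =
    let ρ′ , fires = fires-monotone (fire E σ′ u) fired≤ rest
    in ρ′ , step (0<d , ≤-trans d≤σu (σ≤σ′ u 0<d)) fires
    where
    fired≤ : ∀ w → 0 < outdeg E w → lookup (fire E σ u) w ≤ lookup (fire E σ′ u) w
    fired≤ w 0<dw = subst₂ _≤_ (sym (fire-lookup σ u w)) (sym (fire-lookup σ′ u w))
      (+-monoˡ-≤ (E u w) (∸-monoˡ-≤ (debit u w) (σ≤σ′ w 0<dw)))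

module SimpleGame {n : ℕ} {E : Graph n} {σ₀ : Config n} (simple : Simple E σ₀) where

  open ChipFiring E

  fired-at-most-once : ∀ {p σ} → Fires E σ₀ p σ → ∀ w → count w p ≤ 1
  fired-at-most-once fp w =
    let (τ , (l , fl) , final) , unique = simple
    in ≤-trans (LeastAction.least-action fl final fp w) (count≤1 w l (unique l (τ , fl , final)))

  firable⇒unfired : ∀ {p σ u} → Fires E σ₀ p σ → Firable E σ u → count u p ≡ 0
  firable⇒unfired {p} {u = u} fp firable =
    n≤0⇒n≡0 (≤-pred (subst (_≤ 1) (count-snoc-self u p) (fired-at-most-once (fires-snoc fp firable) u)))

  unfired : List (Fin n) → ℕ
  unfired p = sum (tabulate λ w → 1 ∸ count w p)

  unfired-snoc : ∀ {p σ u} → Fires E σ₀ p σ → Firable E σ u → unfired p ≡ suc (unfired (p ++ [ u ]))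
  unfired-snoc {p} {u = u} fp firable =
    trans (sum-tabulate-update _ _ u (λ w w≢u → cong (1 ∸_) (sym (count-snoc-other p w≢u))) now-fired)
          (+-comm _ 1)
    where
    now-fired : 1 ∸ count u p ≡ 1 ∸ count u (p ++ [ u ]) + 1
    now-fired rewrite count-snoc-self u p | firable⇒unfired fp firable = refl

  greedy-final : ∀ m {p σ} → Fires E σ₀ p σ → unfired p ≤ m →
    ∃ λ τ → Fires E σ (greedy m σ) τ × Final E τ
  greedy-final zero {p} {σ} fp unfired≤0 = σ , done , λ u firable →
    contradiction (≤-trans (lookup≤sum-tabulate (λ w → 1 ∸ count w p) u) unfired≤0)
                  (subst (λ c → 1 ∸ c ≰ 0) (sym (firable⇒unfired fp firable)) λ ())
  greedy-final (suc m) {p} {σ} fp unfired≤m with any? (firable? σ)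
  ... | no ¬firable = σ , done , λ u firable → ¬firable (u , firable)
  ... | yes (u , firable) =
    let τ , fires , final = greedy-final m (fires-snoc fp firable)
                              (≤-pred (subst (_≤ suc m) (unfired-snoc fp firable) unfired≤m))
    in τ , step firable fires , final

  completion : Config n → List (Fin n)
  completion = greedy n

  completion-final : ∀ {p σ} → Fires E σ₀ p σ → ∃ λ τ → Fires E σ (completion σ) τ × Final E τ
  completion-final {p} fp = greedy-final n fp (sum-tabulate-≤-length _ λ w → m∸n≤m 1 (count w p))

  fired-exactly-once : ∀ {⊥ w p σ} → AllFired E σ₀ ⊥ → w ≢ ⊥ → Fires E σ₀ p σ →
    count w p + count w (completion σ) ≡ 1
  fired-exactly-once {w = w} {p} {σ} all-fired w≢⊥ fp =
    let τ , fc , final = completion-final fp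
        execution = fires-++ fp fc
    in trans (sym (count-++ w p (completion σ)))
         (≤-antisym (fired-at-most-once execution w)
                    (∈⇒0<count (all-fired (p ++ completion σ) (τ , execution , final) w w≢⊥)))

module Grounding {n : ℕ} (E : Graph n) (⊥ v : Fin n) (k : ℕ)
                 (⊥-sink : IsSink E ⊥) (v-active : 0 < outdeg E v) where

  open ChipFiring E

  E′ : Graph n
  E′ = groundGraph E v ⊥ k

  v≢⊥ : v ≢ ⊥
  v≢⊥ = active⇒¬sink v-active ⊥-sink

  groundGraph-other : ∀ {u} w → u ≢ v → E′ u w ≡ E u w
  groundGraph-other {u} w u≢v rewrite dec-false (u ≟ v) u≢v = refl

  groundGraph-v : ∀ {w} → w ≢ ⊥ → E′ v w ≡ E v w
  groundGraph-v {w} w≢⊥ rewrite dec-true (v ≟ v) refl | dec-false (w ≟ ⊥) w≢⊥ = refl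

  groundGraph-v⊥ : E′ v ⊥ ≡ E v ⊥ + k
  groundGraph-v⊥ rewrite dec-true (v ≟ v) refl | dec-true (⊥ ≟ ⊥) refl = refl

  outdeg-other : ∀ {u} → u ≢ v → outdeg E′ u ≡ outdeg E u
  outdeg-other u≢v = cong sum (tabulate-cong λ w → groundGraph-other w u≢v)

  outdeg-v : outdeg E′ v ≡ outdeg E v + k
  outdeg-v = sum-tabulate-update (E′ v) (E v) ⊥ (λ w → groundGraph-v) groundGraph-v⊥

  fire-other : ∀ {σ u} → u ≢ v → fire E′ σ u ≡ fire E σ u
  fire-other {σ} {u} u≢v = tabulate-cong λ w →
    cong₂ (λ d e → lookup σ w ∸ (if does (w ≟ u) then d else 0) + e) (outdeg-other u≢v) (groundGraph-other w u≢v)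

  fire-v : ∀ σ → fire E′ (addChips σ v k) v ≡ addChips (fire E σ v) ⊥ k
  fire-v σ = lookup-extensionality _ _ moved
    where
    open ≡-Reasoning
    module F′ = ChipFiring E′
    ⊥≢v : ⊥ ≢ v
    ⊥≢v = v≢⊥ ∘ sym
    at-v : lookup (fire E′ (addChips σ v k) v) v ≡ lookup (addChips (fire E σ v) ⊥ k) v
    at-v = begin
        lookup (fire E′ (addChips σ v k) v) v
      ≡⟨ F′.fire-lookup-self (addChips σ v k) v ⟩
        lookup (addChips σ v k) v ∸ outdeg E′ v + E′ v v
      ≡⟨ cong₂ (λ a d → a ∸ d + E′ v v) (lookup∘updateAt v σ) outdeg-v ⟩
        lookup σ v + k ∸ (outdeg E v + k) + E′ v v
      ≡⟨ cong₂ _+_ (trans (cong₂ _∸_ (+-comm (lookup σ v) k) (+-comm (outdeg E v) k))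
                          ([m+n]∸[m+o]≡n∸o k (lookup σ v) (outdeg E v)))
                   (groundGraph-v v≢⊥) ⟩
        lookup σ v ∸ outdeg E v + E v v
      ≡⟨ fire-lookup-self σ v ⟨
        lookup (fire E σ v) v
      ≡⟨ lookup-addChips-other (fire E σ v) k ⊥≢v ⟨
        lookup (addChips (fire E σ v) ⊥ k) v ∎
    at-⊥ : lookup (fire E′ (addChips σ v k) v) ⊥ ≡ lookup (addChips (fire E σ v) ⊥ k) ⊥
    at-⊥ = begin
        lookup (fire E′ (addChips σ v k) v) ⊥
      ≡⟨ F′.fire-lookup-other (addChips σ v k) ⊥≢v ⟩
        lookup (addChips σ v k) ⊥ + E′ v ⊥
      ≡⟨ cong₂ _+_ (lookup-addChips-other σ k v≢⊥) groundGraph-v⊥ ⟩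
        lookup σ ⊥ + (E v ⊥ + k)
      ≡⟨ +-assoc (lookup σ ⊥) (E v ⊥) k ⟨
        lookup σ ⊥ + E v ⊥ + k
      ≡⟨ cong (_+ k) (fire-lookup-other σ ⊥≢v) ⟨
        lookup (fire E σ v) ⊥ + k
      ≡⟨ lookup∘updateAt ⊥ (fire E σ v) ⟨
        lookup (addChips (fire E σ v) ⊥ k) ⊥ ∎
    at-other : ∀ {w} → w ≢ v → w ≢ ⊥ →
      lookup (fire E′ (addChips σ v k) v) w ≡ lookup (addChips (fire E σ v) ⊥ k) w
    at-other {w} w≢v w≢⊥ = begin
        lookup (fire E′ (addChips σ v k) v) w
      ≡⟨ F′.fire-lookup-other (addChips σ v k) w≢v ⟩
        lookup (addChips σ v k) w + E′ v w
      ≡⟨ cong₂ _+_ (lookup-addChips-other σ k (w≢v ∘ sym)) (groundGraph-v w≢⊥) ⟩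
        lookup σ w + E v w
      ≡⟨ fire-lookup-other σ w≢v ⟨
        lookup (fire E σ v) w
      ≡⟨ lookup-addChips-other (fire E σ v) k (w≢⊥ ∘ sym) ⟨
        lookup (addChips (fire E σ v) ⊥ k) w ∎
    moved : ∀ w → lookup (fire E′ (addChips σ v k) v) w ≡ lookup (addChips (fire E σ v) ⊥ k) w
    moved w with w ≟ v | w ≟ ⊥
    ... | yes refl | _ = at-v
    ... | no _ | yes refl = at-⊥
    ... | no w≢v | no w≢⊥ = at-other w≢v w≢⊥

  firable-other→ : ∀ {σ u} w → u ≢ v → Firable E σ u → Firable E′ (addChips σ w k) u
  firable-other→ {σ} {u} w u≢v (0<d , d≤σu) =
    subst (0 <_) (sym (outdeg-other u≢v)) 0<d ,
    subst (_≤ lookup (addChips σ w k) u) (sym (outdeg-other u≢v)) (≤-trans d≤σu (lookup-addChips-≥ σ w k u))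

  firable-other← : ∀ {σ u w} → u ≢ v → w ≢ u → Firable E′ (addChips σ w k) u → Firable E σ u
  firable-other← {σ} u≢v w≢u (0<d′ , d′≤σu) =
    subst (0 <_) (outdeg-other u≢v) 0<d′ ,
    subst₂ _≤_ (outdeg-other u≢v) (lookup-addChips-other σ k w≢u) d′≤σu

  firable-v→ : ∀ {σ} → Firable E σ v → Firable E′ (addChips σ v k) v
  firable-v→ {σ} (0<d , d≤σv) =
    subst (0 <_) (sym outdeg-v) (≤-trans 0<d (m≤m+n _ k)) ,
    subst₂ _≤_ (sym outdeg-v) (sym (lookup∘updateAt v σ)) (+-monoˡ-≤ k d≤σv)

  firable-v← : ∀ {σ} w → Firable E′ (addChips σ w k) v → Firable E σ v
  firable-v← {σ} w (_ , d′≤σv) =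
    v-active ,
    +-cancelʳ-≤ k _ _ (≤-trans (≤-reflexive (sym outdeg-v)) (≤-trans d′≤σv (lookup-addChips-≤ σ w k v)))

  module Game {σ₀ : Config n} (simple : Simple E σ₀) (all-fired : AllFired E σ₀ ⊥) where

    open SimpleGame simple

    -- the k extra chips sit on v until v has fired, and on ⊥ afterwards
    site : ℕ → Fin n
    site zero = v
    site (suc _) = ⊥

    grounded : ℕ → Config n → Config n
    grounded c σ = addChips σ (site c) k

    step-grounded : ∀ {a σ u} → Fires E σ₀ a σ → Firable E σ u →
      Firable E′ (grounded (count v a) σ) u ×
      fire E′ (grounded (count v a) σ) u ≡ grounded (count v (a ++ [ u ])) (fire E σ u)
    step-grounded {a} {σ} {u} fa firable with v ≟ u
    ... | yes refl rewrite count-snoc-self v a | firable⇒unfired fa firable = firable-v→ {σ} firable , fire-v σ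
    ... | no v≢u rewrite count-snoc-other a v≢u =
      firable-other→ {σ} (site (count v a)) (v≢u ∘ sym) firable ,
      trans (fire-other {grounded (count v a) σ} (v≢u ∘ sym)) (fire-addChips {σ} (site (count v a)) k (proj₂ firable))

    ungrounded-firable : ∀ {c σ u} → Firable E′ (grounded c σ) u → Firable E σ u
    ungrounded-firable {c} {σ} {u} firable′ with v ≟ u
    ... | yes refl = firable-v← {σ} (site c) firable′
    ... | no v≢u = firable-other← {σ} (v≢u ∘ sym) (site≢u c) firable′
      where
      site≢u : ∀ c → site c ≢ u
      site≢u zero = v≢u
      site≢u (suc _) = active⇒¬sink (subst (0 <_) (outdeg-other (v≢u ∘ sym)) (proj₁ firable′)) ⊥-sink ∘ sym

    simulate : ∀ {a σ b ρ} → Fires E σ₀ a σ → Fires E σ b ρ →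
      Fires E′ (grounded (count v a) σ) b (grounded (count v (a ++ b)) ρ)
    simulate {a} fa done rewrite ++-identityʳ a = done
    simulate {a} {ρ = ρ} fa (step {v = u} {l = b} firable rest) =
      let firable′ , fired = step-grounded fa firable
      in step firable′ (subst₂ (λ τ l → Fires E′ τ b (grounded (count v l) ρ)) (sym fired) (++-assoc a [ u ] b)
                                (simulate (fires-snoc fa firable) rest))

    lift : ∀ {a σ b τ} → Fires E σ₀ a σ → Fires E′ (grounded (count v a) σ) b τ →
      ∃ λ ρ → Fires E σ b ρ × τ ≡ grounded (count v (a ++ b)) ρ
    lift {a} {σ} fa done = σ , done , cong (λ l → grounded (count v l) σ) (sym (++-identityʳ a))
    lift {a} {σ} {τ = τ} fa (step {v = u} {l = b} firable′ rest) =
      let firable = ungrounded-firable {count v a} {σ} firable′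
          ρ , fires , τ≡ = lift (fires-snoc fa firable)
                                (subst (λ σ′ → Fires E′ σ′ b τ) (proj₂ (step-grounded fa firable)) rest)
      in ρ , step firable fires , trans τ≡ (cong (λ l → grounded (count v l) ρ) (++-assoc a [ u ] b))

    toGrounded : Config n → Config n
    toGrounded σ = grounded (1 ∸ count v (completion σ)) σ

    -- v still fires from τ once the k chips are taken off it exactly when they sit on v
    fromGrounded : Config n → Config n
    fromGrounded τ = removeChips τ (site (1 ∸ count v (completion (removeChips τ v k)))) k

    toGrounded-history : ∀ {p σ} → Fires E σ₀ p σ → toGrounded σ ≡ grounded (count v p) σ
    toGrounded-history {p} {σ} fp = cong (λ c → grounded c σ)
      (trans (cong (_∸ count v (completion σ)) (sym (fired-exactly-once all-fired v≢⊥ fp)))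
             (m+n∸n≡m (count v p) (count v (completion σ))))

    -- Otherwise the completion would be legal from σ too (it has at least as many chips off ⊥), firing v twice.
    fired-v-stays-fired : ∀ {p σ} → Fires E σ₀ p σ → 0 < count v p →
      count v (completion (removeChips (addChips σ ⊥ k) v k)) ≡ 0
    fired-v-stays-fired {p} {σ} fp 0<c =
      let _ , from-ρ = greedy-fires n ρ
          _ , from-σ = fires-monotone σ ρ≤σ from-ρ
          at-most-once = subst (_≤ 1) (count-++ v p (completion ρ)) (fired-at-most-once (fires-++ fp from-σ) v)
      in n≤0⇒n≡0 (+-cancelˡ-≤ 1 _ 0 (≤-trans (+-monoˡ-≤ _ 0<c) at-most-once))
      where
      ρ = removeChips (addChips σ ⊥ k) v k
      ρ≤σ : ∀ w → 0 < outdeg E w → lookup ρ w ≤ lookup σ w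
      ρ≤σ w 0<d = ≤-trans (lookup-removeChips-≤ (addChips σ ⊥ k) v k w)
                          (≤-reflexive (lookup-addChips-other σ k (active⇒¬sink 0<d ⊥-sink ∘ sym)))

    fromGrounded-grounded : ∀ {p σ} → Fires E σ₀ p σ → fromGrounded (grounded (count v p) σ) ≡ σ
    fromGrounded-grounded {p} {σ} fp with count v p in c≡
    ... | zero rewrite removeChips-addChips σ v k
                     | trans (sym (cong (_+ count v (completion σ)) c≡)) (fired-exactly-once all-fired v≢⊥ fp)
      = removeChips-addChips σ v k
    ... | suc _ rewrite fired-v-stays-fired fp (subst (0 <_) (sym c≡) (s≤s z≤n)) = removeChips-addChips σ ⊥ k

    reach-σ₀ : Reach E σ₀ σ₀
    reach-σ₀ = [] , done

    toGrounded-σ₀ : toGrounded σ₀ ≡ addChips σ₀ v k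
    toGrounded-σ₀ = toGrounded-history done

    simulate-reach : ∀ {σ τ} → Reach E σ₀ σ → Reach E σ τ → Reach E′ (toGrounded σ) (toGrounded τ)
    simulate-reach (p , fp) (r , fr) =
      r , subst₂ (λ σ′ τ′ → Fires E′ σ′ r τ′)
                 (sym (toGrounded-history fp)) (sym (toGrounded-history (fires-++ fp fr)))
                 (simulate fp fr)

    lift-reach : ∀ {σ τ} → Reach E σ₀ σ → Reach E′ (toGrounded σ) τ →
      ∃ λ ρ → Reach E σ ρ × τ ≡ toGrounded ρ
    lift-reach {τ = τ} (p , fp) (r , fr′) =
      let ρ , fr , τ≡ = lift fp (subst (λ σ′ → Fires E′ σ′ r τ) (toGrounded-history fp) fr′)
      in ρ , (r , fr) , trans τ≡ (sym (toGrounded-history (fires-++ fp fr)))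

    grounded-reachable : ∀ {τ} → Reach E′ (addChips σ₀ v k) τ →
      ∃ λ σ → Reach E σ₀ σ × τ ≡ toGrounded σ
    grounded-reachable {τ} reach′ =
      lift-reach reach-σ₀ (subst (λ σ′ → Reach E′ σ′ τ) (sym toGrounded-σ₀) reach′)

    fromGrounded-toGrounded : ∀ σ → Reach E σ₀ σ → fromGrounded (toGrounded σ) ≡ σ
    fromGrounded-toGrounded σ (p , fp) = trans (cong fromGrounded (toGrounded-history fp)) (fromGrounded-grounded fp)

    toGrounded-reachable : ∀ σ → Reach E σ₀ σ → Reach E′ (addChips σ₀ v k) (toGrounded σ)
    toGrounded-reachable σ reach =
      subst (λ σ′ → Reach E′ σ′ (toGrounded σ)) toGrounded-σ₀ (simulate-reach reach-σ₀ reach)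

    fromGrounded-reachable : ∀ τ → Reach E′ (addChips σ₀ v k) τ → Reach E σ₀ (fromGrounded τ)
    fromGrounded-reachable τ reach′ =
      let σ , reach , τ≡ = grounded-reachable reach′
      in subst (Reach E σ₀) (sym (trans (cong fromGrounded τ≡) (fromGrounded-toGrounded σ reach))) reach

    toGrounded-fromGrounded : ∀ τ → Reach E′ (addChips σ₀ v k) τ → toGrounded (fromGrounded τ) ≡ τ
    toGrounded-fromGrounded τ reach′ =
      let σ , reach , τ≡ = grounded-reachable reach′
      in trans (cong (toGrounded ∘ fromGrounded) τ≡)
               (trans (cong toGrounded (fromGrounded-toGrounded σ reach)) (sym τ≡))

    reach⇔grounded-reach : ∀ σ τ → Reach E σ₀ σ → Reach E σ₀ τ →
      Reach E σ τ ⇔ Reach E′ (toGrounded σ) (toGrounded τ)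
    reach⇔grounded-reach σ τ reach-σ reach-τ = mk⇔ (simulate-reach reach-σ) λ reach′ →
      let ρ , σ→ρ , τ≡ = lift-reach reach-σ reach′
          τ≡ρ = trans (sym (fromGrounded-toGrounded τ reach-τ))
                      (trans (cong fromGrounded τ≡) (fromGrounded-toGrounded ρ (reach-trans reach-σ σ→ρ)))
      in subst (Reach E σ) (sym τ≡ρ) σ→ρ

lemma2 : {n : ℕ} (E : Graph n) (σ₀ : Config n) (⊥ v : Fin n) (k : ℕ) →
    NoLoops E → UniqueSink E ⊥ → Simple E σ₀ → AllFired E σ₀ ⊥ →
    v ≢ ⊥ →
    Equivalent E σ₀ (groundGraph E v ⊥ k) (groundConfig σ₀ v k)
lemma2 E σ₀ ⊥ v k _ (⊥-sink , sinks-are-⊥) simple all-fired v≢⊥ =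
  toGrounded , fromGrounded , toGrounded-reachable , fromGrounded-reachable ,
  fromGrounded-toGrounded , toGrounded-fromGrounded , reach⇔grounded-reach
  where
  v-active : 0 < outdeg E v
  v-active = ChipFiring.¬sink⇒active E (v≢⊥ ∘ sinks-are-⊥ v)
  open Grounding.Game E ⊥ v k ⊥-sink v-active simple all-fired
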